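{- If $G$ is a tree that is not a star, then its complement $\overline{G}$ is connected and $rc(\overline{G})\leq 3$.
   Context: All graphs are finite, undirected and simple. For an edge-coloring $c:E(H)\to\{1,\dots,k\}$ (adjacent edges may receive the same color), a path is rainbow if no two of its edges have the same color; $H$ is rainbow connected under $c$ if every two vertices are joined by a rainbow path. The rainbow connection number $rc(H)$ of a nontrivial connected graph $H$ is the minimum $k$ for which such a coloring with $k$ colors exists. $\overline{G}$ denotes the complement of $G$. -}

module Defs where

open import Data.Nat using (ℕ; _≤_)
open import Data.Fin using (Fin; _≟_)
open import Data.Bool using (Bool; true; false; not; _∧_)
open import Data.List using (List; []; _∷_; length)
open import Data.List.Relation.Unary.Unique.Propositional using (Unique)
open import Data.Product using (Σ; _×_; _,_; ∃)
open import Data.Sum using (_⊎_)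
open import Relation.Nullary using (¬_; ⌊_⌋; yes; no)
open import Relation.Binary.PropositionalEquality using (_≡_; _≢_; refl; sym; cong)

record Graph (n : ℕ) : Set where
  field
    adj    : Fin n → Fin n → Bool
    adj-sym : ∀ u v → adj u v ≡ adj v u
    irrefl : ∀ u → adj u u ≡ false
open Graph public

Adj : ∀ {n} → Graph n → Fin n → Fin n → Set
Adj G u v = adj G u v ≡ true

private
  eqb : ∀ {n} → Fin n → Fin n → Bool
  eqb u v = ⌊ u ≟ v ⌋

  eqb-sym : ∀ {n} (u v : Fin n) → eqb u v ≡ eqb v u
  eqb-sym u v with u ≟ v | v ≟ u
  ... | yes _ | yes _ = refl
  ... | no _  | no _  = refl
  ... | yes p | no q  with q (sym p)
  ... | ()
  eqb-sym u v | no q | yes p with q (sym p)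
  ... | ()

  eqb-refl : ∀ {n} (u : Fin n) → eqb u u ≡ true
  eqb-refl u with u ≟ u
  ... | yes _ = refl
  ... | no q with q refl
  ... | ()

  ∧-false : ∀ (b : Bool) → b ∧ false ≡ false
  ∧-false true = refl
  ∧-false false = refl

complement : ∀ {n} → Graph n → Graph n
complement {n} G = record
  { adj    = λ u v → not (adj G u v) ∧ not (eqb u v)
  ; adj-sym = λ u v → Relation.Binary.PropositionalEquality.cong₂ (λ a b → not a ∧ not b) (Graph.adj-sym G u v) (eqb-sym u v)
  ; irrefl = λ u → Relation.Binary.PropositionalEquality.trans
               (cong (λ b → not (adj G u u) ∧ not b) (eqb-refl u)) (∧-false (not (adj G u u)))
  }

data Walk {n : ℕ} (G : Graph n) : Fin n → Fin n → Set where
  []  : ∀ {u} → Walk G u u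
  _∷_ : ∀ {u v w} → Adj G u v → Walk G v w → Walk G u w

vertices : ∀ {n} {G : Graph n} {u w} → Walk G u w → List (Fin n)
vertices {u = u} []            = u ∷ []
vertices (_∷_ {u = u} _ p)     = u ∷ vertices p

IsPath : ∀ {n} {G : Graph n} {u w} → Walk G u w → Set
IsPath p = Unique (vertices p)

Connected : ∀ {n} → Graph n → Set
Connected G = ∀ u v → Σ (Walk G u v) IsPath

HasCycle : ∀ {n} → Graph n → Set
HasCycle G = Σ _ λ u → Σ _ λ w → Adj G w u ×
  Σ (Walk G u w) λ p → IsPath p × 3 ≤ length (vertices p)

IsTree : ∀ {n} → Graph n → Set
IsTree G = Connected G × ¬ HasCycle G

IsStar : ∀ {n} → Graph n → Set
IsStar {n} G = Σ (Fin n) λ c → ∀ u v →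
  (Adj G u v → (u ≡ c ⊎ v ≡ c)) × ((u ≡ c ⊎ v ≡ c) → u ≢ v → Adj G u v)

-- Edge colouring with colours Fin k (a symmetric function on vertex pairs;
-- only its values on edges matter).
record EdgeColouring {n : ℕ} (G : Graph n) (k : ℕ) : Set where
  field
    col     : Fin n → Fin n → Fin k
    col-sym : ∀ u v → col u v ≡ col v u
open EdgeColouring public

edgeColours : ∀ {n k} {G : Graph n} → EdgeColouring G k → ∀ {u w} → Walk G u w → List (Fin k)
edgeColours c []                   = []
edgeColours c (_∷_ {u = u} {v = v} _ p) = col c u v ∷ edgeColours c p

RainbowPath : ∀ {n k} {G : Graph n} → EdgeColouring G k → ∀ {u w} → Walk G u w → Set
RainbowPath c p = IsPath p × Unique (edgeColours c p)

RainbowConnected : ∀ {n k} {G : Graph n} → EdgeColouring G k → Set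
RainbowConnected {G = G} c = ∀ u v → Σ (Walk G u v) (RainbowPath c)

rc≤ : ∀ {n} → Graph n → ℕ → Set
rc≤ G k = Σ (EdgeColouring G k) RainbowConnected

-- A tree is bipartite: colour each vertex by the parity of its distance
-- from a root, since a closed walk of odd length always contains a cycle.
-- In the complement, colour the edges inside one class 0, inside the other
-- class 1, and across the classes 2. Vertices in the same class, and
-- vertices non-adjacent in the tree, are adjacent in the complement, so only
-- a tree edge uv needs a detour: u a v or u b v through a mate a of u (or b
-- of v) that is not a tree neighbour of the other end, or else u a b v. If
-- this last detour fails, either one class is a single vertex, and the tree
-- is a star, or ab is a tree edge and u v a b is a 4-cycle.
module Submission where

open import Defs
open import Data.Nat using (ℕ; zero; suc; _+_; _≤_; _<_; s≤s; z≤n)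
open import Data.Nat.Base using (parity)
open import Data.Nat.Induction using (<-wellFounded)
open import Data.Nat.Properties using (m≤m+n; m<n+m; +-monoʳ-<; ≤-<-trans; +-comm)
open import Data.Parity.Base using (Parity; 0ℙ; 1ℙ) renaming (_+_ to _+ℙ_)
open import Data.Parity.Properties using (+-homo-+; p+p⁻¹≡1ℙ) renaming (_≟_ to _≟ℙ_)
open import Data.Fin using (Fin; _≟_; #_) renaming (zero to fzero)
open import Data.Fin.Properties using (any?)
open import Data.Bool using (true; false)
open import Data.Bool.Properties using (¬-not) renaming (_≟_ to _≟ᵇ_)
open import Data.List using (length)
open import Data.List.Membership.Propositional using (_∈_)
open import Data.List.Relation.Unary.All using ([]; _∷_)
open import Data.List.Relation.Unary.All.Properties.Core using (¬Any⇒All¬)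
open import Data.List.Relation.Unary.AllPairs using ([]; _∷_)
open import Data.List.Relation.Unary.Any using (here; there)
import Data.List.Relation.Unary.Any as Any
open import Data.Product using (Σ; ∃; _×_; _,_; proj₁; proj₂)
open import Data.Sum using (_⊎_; inj₁; inj₂)
open import Data.Empty using (⊥-elim)
open import Induction.WellFounded using (Acc; acc)
open import Relation.Nullary using (¬_; yes; no)
open import Relation.Nullary.Decidable using (¬?; _×-dec_)
open import Relation.Unary using (Decidable)
open import Relation.Binary.PropositionalEquality
open ≡-Reasoning

parity-cancel-even : ∀ a c b → parity c ≡ 0ℙ → parity (a + (c + b)) ≡ parity (a + b)
parity-cancel-even a c b even = begin
  parity (a + (c + b))                ≡⟨ +-homo-+ a (c + b) ⟩
  parity a +ℙ parity (c + b)          ≡⟨ cong (parity a +ℙ_) (+-homo-+ c b) ⟩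
  parity a +ℙ (parity c +ℙ parity b)  ≡⟨ cong (λ q → parity a +ℙ (q +ℙ parity b)) even ⟩
  parity a +ℙ parity b                ≡⟨ +-homo-+ a b ⟨
  parity (a + b)                      ∎

parity-+-suc≡1ℙ : ∀ m n → parity m ≡ parity n → parity (m + suc n) ≡ 1ℙ
parity-+-suc≡1ℙ m n same = begin
  parity (m + suc n)              ≡⟨ +-homo-+ m (suc n) ⟩
  parity m +ℙ parity (1 + n)      ≡⟨ cong₂ _+ℙ_ same (+-homo-+ 1 n) ⟩
  parity n +ℙ (1ℙ +ℙ parity n)    ≡⟨ p+p⁻¹≡1ℙ (parity n) ⟩
  1ℙ                              ∎

≢-≢⇒≡ : ∀ {p q r : Parity} → p ≢ r → q ≢ r → p ≡ q
≢-≢⇒≡ {0ℙ} {0ℙ} _   _   = refl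
≢-≢⇒≡ {1ℙ} {1ℙ} _   _   = refl
≢-≢⇒≡ {0ℙ} {1ℙ} {0ℙ} p≢r _   = ⊥-elim (p≢r refl)
≢-≢⇒≡ {0ℙ} {1ℙ} {1ℙ} _   q≢r = ⊥-elim (q≢r refl)
≢-≢⇒≡ {1ℙ} {0ℙ} {0ℙ} _   q≢r = ⊥-elim (q≢r refl)
≢-≢⇒≡ {1ℙ} {0ℙ} {1ℙ} p≢r _   = ⊥-elim (p≢r refl)

module GraphWalks {n : ℕ} (G : Graph n) where

  private variable u v w x y : Fin n

  Adj-sym : Adj G u v → Adj G v u
  Adj-sym {u} {v} e = trans (adj-sym G v u) e

  Adj-irrefl : ¬ Adj G u u
  Adj-irrefl {u} e with trans (sym e) (irrefl G u)
  ... | ()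

  Adj⇒≢ : Adj G u v → u ≢ v
  Adj⇒≢ e refl = Adj-irrefl e

  len : Walk G u w → ℕ
  len []      = 0
  len (_ ∷ p) = suc (len p)

  infixr 5 _++_
  _++_ : Walk G u v → Walk G v w → Walk G u w
  []      ++ q = q
  (e ∷ p) ++ q = e ∷ (p ++ q)

  len-++ : (p : Walk G u v) (q : Walk G v w) → len (p ++ q) ≡ len p + len q
  len-++ []      q = refl
  len-++ (e ∷ p) q = cong suc (len-++ p q)

  len-++-++ : (A : Walk G u v) (C : Walk G v x) (B : Walk G x w) →
    len (A ++ C ++ B) ≡ len A + (len C + len B)
  len-++-++ A C B = trans (len-++ A (C ++ B)) (cong (len A +_) (len-++ C B))

  reverse : Walk G u w → Walk G w u
  reverse []      = []
  reverse (e ∷ p) = reverse p ++ (Adj-sym e ∷ [])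

  len-reverse : (p : Walk G u w) → len (reverse p) ≡ len p
  len-reverse []      = refl
  len-reverse (e ∷ p) = begin
    len (reverse p ++ (Adj-sym e ∷ []))  ≡⟨ len-++ (reverse p) _ ⟩
    len (reverse p) + 1                   ≡⟨ +-comm (len (reverse p)) 1 ⟩
    suc (len (reverse p))                 ≡⟨ cong suc (len-reverse p) ⟩
    suc (len p)                           ∎

  vertices-nonempty : (p : Walk G u w) → 1 ≤ length (vertices p)
  vertices-nonempty []      = s≤s z≤n
  vertices-nonempty (_ ∷ _) = s≤s z≤n

  splitAt : (p : Walk G u w) → x ∈ vertices p →
    Σ (Walk G u x) λ A → Σ (Walk G x w) λ B → p ≡ A ++ B
  splitAt []      (here refl) = [] , [] , refl
  splitAt (e ∷ p) (here refl) = [] , e ∷ p , refl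
  splitAt (e ∷ p) (there x∈p) with splitAt p x∈p
  ... | A , B , refl = e ∷ A , B , refl

  data Repeats : Walk G u w → Set where
    repeats : (A : Walk G u x) (C : Walk G x x) (B : Walk G x w) →
      0 < len C → Repeats (A ++ C ++ B)

  isPath⊎repeats : (p : Walk G u w) → IsPath p ⊎ Repeats p
  isPath⊎repeats []            = inj₁ ([] ∷ [])
  isPath⊎repeats (_∷_ {u} e p) with isPath⊎repeats p
  ... | inj₂ (repeats A C B C≢[]) = inj₂ (repeats (e ∷ A) C B C≢[])
  ... | inj₁ p-path with Any.any? (u ≟_) (vertices p)
  ...   | no u∉p  = inj₁ (¬Any⇒All¬ (vertices p) u∉p ∷ p-path)
  ...   | yes u∈p with splitAt p u∈p
  ...     | A , B , refl = inj₂ (repeats [] (e ∷ A) B (s≤s z≤n))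

  -- A closed walk e ∷ p whose tail p is a path is a cycle unless it has at
  -- most two edges, and those cases have even length or a loop edge.
  oddClosedPath⇒cycle : (e : Adj G x y) (p : Walk G y x) → IsPath p →
    parity (len (e ∷ p)) ≡ 1ℙ → HasCycle G
  oddClosedPath⇒cycle e []                 _      _  = ⊥-elim (Adj-irrefl e)
  oddClosedPath⇒cycle e (_ ∷ [])           _      ()
  oddClosedPath⇒cycle e p@(_ ∷ _ ∷ q) p-path _  =
    _ , _ , e , p , p-path , s≤s (s≤s (vertices-nonempty q))

  -- Parities add, so the loop C or the closed walk A ++ B left after cutting
  -- it out is odd.
  shorterOddClosedWalk : (A : Walk G x y) (C : Walk G y y) (B : Walk G y x) →
    0 < len A → 0 < len C → parity (len (A ++ C ++ B)) ≡ 1ℙ →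
    ∃ λ z → Σ (Walk G z z) λ W → len W < len (A ++ C ++ B) × parity (len W) ≡ 1ℙ
  shorterOddClosedWalk A C B A≢[] C≢[] odd with parity (len C) in C-parity
  ... | 1ℙ = _ , C , subst (len C <_) (sym (len-++-++ A C B)) C-shorter , C-parity
    where
    C-shorter : len C < len A + (len C + len B)
    C-shorter = ≤-<-trans (m≤m+n (len C) (len B)) (m<n+m (len C + len B) A≢[])
  ... | 0ℙ = _ , A ++ B , AB-shorter , AB-odd
    where
    AB-shorter : len (A ++ B) < len (A ++ C ++ B)
    AB-shorter rewrite len-++ A B | len-++-++ A C B = +-monoʳ-< (len A) (m<n+m (len B) C≢[])
    AB-odd : parity (len (A ++ B)) ≡ 1ℙ
    AB-odd = begin
      parity (len (A ++ B))              ≡⟨ cong parity (len-++ A B) ⟩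
      parity (len A + len B)             ≡⟨ parity-cancel-even (len A) (len C) (len B) C-parity ⟨
      parity (len A + (len C + len B))   ≡⟨ cong parity (len-++-++ A C B) ⟨
      parity (len (A ++ C ++ B))         ≡⟨ odd ⟩
      1ℙ                                 ∎

  oddClosedWalk⇒cycle : (W : Walk G x x) → parity (len W) ≡ 1ℙ → HasCycle G
  oddClosedWalk⇒cycle W = go W (<-wellFounded (len W))
    where
    go : (W : Walk G x x) → Acc _<_ (len W) → parity (len W) ≡ 1ℙ → HasCycle G
    go []      _             ()
    go (e ∷ p) (acc shorter) odd with isPath⊎repeats p
    ... | inj₁ p-path = oddClosedPath⇒cycle e p p-path odd
    ... | inj₂ (repeats A C B C≢[])
        with shorterOddClosedWalk (e ∷ A) C B (s≤s z≤n) C≢[] odd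
    ...   | _ , W′ , W′-shorter , W′-odd = go W′ (shorter W′-shorter) W′-odd

  square⇒cycle : Adj G u v → Adj G v w → Adj G w x → Adj G x u →
    u ≢ w → v ≢ x → HasCycle G
  square⇒cycle uv vw wx xu u≢w v≢x =
    _ , _ , xu , uv ∷ vw ∷ wx ∷ [] ,
    ((Adj⇒≢ uv ∷ u≢w ∷ ≢-sym (Adj⇒≢ xu) ∷ []) ∷
     (Adj⇒≢ vw ∷ v≢x ∷ []) ∷ (Adj⇒≢ wx ∷ []) ∷ [] ∷ []) ,
    s≤s (s≤s (s≤s z≤n))

  complement-adj : u ≢ v → adj G u v ≡ false → Adj (complement G) u v
  complement-adj {u} {v} u≢v uv with u ≟ v
  ... | yes u≡v = ⊥-elim (u≢v u≡v)
  ... | no  _ rewrite uv = refl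

module _ {n k : ℕ} {H : Graph n} (c : EdgeColouring H k) where

  open GraphWalks H using (Adj⇒≢)

  private variable u v a b : Fin n

  rainbow₁ : (e : Adj H u v) → RainbowPath c (e ∷ [])
  rainbow₁ e = ((Adj⇒≢ e ∷ []) ∷ [] ∷ []) , ([] ∷ [])

  rainbow₂ : (ua : Adj H u a) (av : Adj H a v) → u ≢ v →
    col c u a ≢ col c a v → RainbowPath c (ua ∷ av ∷ [])
  rainbow₂ ua av u≢v ua≢av =
    ((Adj⇒≢ ua ∷ u≢v ∷ []) ∷ (Adj⇒≢ av ∷ []) ∷ [] ∷ []) ,
    ((ua≢av ∷ []) ∷ [] ∷ [])

  rainbow₃ : (ua : Adj H u a) (ab : Adj H a b) (bv : Adj H b v) →
    u ≢ b → u ≢ v → a ≢ v →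
    col c u a ≢ col c a b → col c u a ≢ col c b v → col c a b ≢ col c b v →
    RainbowPath c (ua ∷ ab ∷ bv ∷ [])
  rainbow₃ ua ab bv u≢b u≢v a≢v ua≢ab ua≢bv ab≢bv =
    ((Adj⇒≢ ua ∷ u≢b ∷ u≢v ∷ []) ∷ (Adj⇒≢ ab ∷ a≢v ∷ []) ∷ (Adj⇒≢ bv ∷ []) ∷ [] ∷ []) ,
    ((ua≢ab ∷ ua≢bv ∷ []) ∷ (ab≢bv ∷ []) ∷ [] ∷ [])

  rainbowConnected⇒connected : RainbowConnected c → Connected H
  rainbowConnected⇒connected rc u v = proj₁ (rc u v) , proj₁ (proj₂ (rc u v))

colour : Parity → Parity → Fin 3
colour 0ℙ 0ℙ = # 0
colour 1ℙ 1ℙ = # 1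
colour _  _  = # 2

colour-sym : ∀ p q → colour p q ≡ colour q p
colour-sym 0ℙ 0ℙ = refl
colour-sym 0ℙ 1ℙ = refl
colour-sym 1ℙ 0ℙ = refl
colour-sym 1ℙ 1ℙ = refl

colour-across : ∀ {p q} → p ≢ q → colour p q ≡ # 2
colour-across {0ℙ} {0ℙ} p≢q = ⊥-elim (p≢q refl)
colour-across {0ℙ} {1ℙ} _   = refl
colour-across {1ℙ} {0ℙ} _   = refl
colour-across {1ℙ} {1ℙ} p≢q = ⊥-elim (p≢q refl)

colour-within≢across : ∀ {p q r s} → p ≡ q → r ≢ s → colour p q ≢ colour r s
colour-within≢across {0ℙ} refl r≢s eq with trans eq (colour-across r≢s)
... | ()
colour-within≢across {1ℙ} refl r≢s eq with trans eq (colour-across r≢s)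
... | ()

colour-within-injective : ∀ {p q r s} → p ≡ q → r ≡ s → colour p q ≡ colour r s → p ≡ r
colour-within-injective {0ℙ} {r = 0ℙ} refl refl _  = refl
colour-within-injective {1ℙ} {r = 1ℙ} refl refl _  = refl
colour-within-injective {0ℙ} {r = 1ℙ} refl refl ()
colour-within-injective {1ℙ} {r = 0ℙ} refl refl ()

module TreeComplement {n : ℕ} (G : Graph n) (connected : Connected G)
                      (acyclic : ¬ HasCycle G) (root : Fin n) where

  open GraphWalks G

  private variable u v a b : Fin n

  side : Fin n → Parity
  side v = parity (len (proj₁ (connected root v)))

  side-≢ : Adj G u v → side u ≢ side v
  side-≢ {u} {v} e same = acyclic (oddClosedWalk⇒cycle (pu ++ e ∷ reverse pv) odd)
    where
    pu : Walk G root u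
    pu = proj₁ (connected root u)
    pv : Walk G root v
    pv = proj₁ (connected root v)
    odd : parity (len (pu ++ e ∷ reverse pv)) ≡ 1ℙ
    odd = begin
      parity (len (pu ++ e ∷ reverse pv))      ≡⟨ cong parity (len-++ pu _) ⟩
      parity (len pu + suc (len (reverse pv)))  ≡⟨ cong (λ m → parity (len pu + suc m)) (len-reverse pv) ⟩
      parity (len pu + suc (len pv))            ≡⟨ parity-+-suc≡1ℙ (len pu) (len pv) same ⟩
      1ℙ                                        ∎

  side-≢⇒≢ : side u ≢ side v → u ≢ v
  side-≢⇒≢ sides refl = sides refl

  sameSide⇒¬adj : side u ≡ side v → adj G u v ≡ false
  sameSide⇒¬adj {u} {v} same with adj G u v in uv
  ... | true  = ⊥-elim (side-≢ uv same)
  ... | false = refl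

  Ḡ : Graph n
  Ḡ = complement G

  colouring : EdgeColouring Ḡ 3
  colouring = record
    { col     = λ u v → colour (side u) (side v)
    ; col-sym = λ u v → colour-sym (side u) (side v)
    }

  Mate : Fin n → Fin n → Set
  Mate x a = side a ≡ side x × a ≢ x

  mate? : ∀ x → Decidable (Mate x)
  mate? x a = (side a ≟ℙ side x) ×-dec ¬? (a ≟ x)

  nonNeighbourMate? : ∀ x y → Decidable (λ a → Mate x a × adj G a y ≡ false)
  nonNeighbourMate? x y a = mate? x a ×-dec (adj G a y ≟ᵇ false)

  noMate⇒lonely : ¬ ∃ (Mate u) → ∀ x → side x ≡ side u → x ≡ u
  noMate⇒lonely {u} noMate x same with x ≟ u
  ... | yes x≡u = x≡u
  ... | no  x≢u = ⊥-elim (noMate (x , same , x≢u))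

  lonely⇒star : (∀ x → side x ≡ side u → x ≡ u) →
    (∀ y → side y ≢ side u → Adj G u y) → IsStar G
  lonely⇒star {u} lonely adjacent = u , λ x y → throughCentre x y , toCentre x y
    where
    throughCentre : ∀ x y → Adj G x y → x ≡ u ⊎ y ≡ u
    throughCentre x y xy with side x ≟ℙ side u | side y ≟ℙ side u
    ... | yes x-side | _          = inj₁ (lonely x x-side)
    ... | no  _      | yes y-side = inj₂ (lonely y y-side)
    ... | no  x-side | no  y-side = ⊥-elim (side-≢ xy (≢-≢⇒≡ x-side y-side))
    toCentre : ∀ x y → x ≡ u ⊎ y ≡ u → x ≢ y → Adj G x y
    toCentre x y (inj₁ refl) x≢y = adjacent y λ y-side → x≢y (sym (lonely y y-side))
    toCentre x y (inj₂ refl) x≢y = Adj-sym (adjacent x λ x-side → x≢y (lonely x x-side))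

  adjacentToOtherSide : Adj G u v → ¬ ∃ (λ b → Mate v b × adj G b u ≡ false) →
    ∀ y → side y ≢ side u → Adj G u y
  adjacentToOtherSide {u} {v} uv noMate y y-side with y ≟ v
  ... | yes refl = uv
  ... | no  y≢v  = Adj-sym (¬-not λ yu → noMate (y , (y-mate , y≢v) , yu))
    where
    y-mate : side y ≡ side v
    y-mate = ≢-≢⇒≡ y-side (≢-sym (side-≢ uv))

  rainbowViaMateOfSource : Mate u a → adj G a v ≡ false → side u ≢ side v →
    Σ (Walk Ḡ u v) (RainbowPath colouring)
  rainbowViaMateOfSource {u} {a} {v} (a-side , a≢u) a≁v u-v =
    ua ∷ av ∷ [] ,
    rainbow₂ colouring ua av (side-≢⇒≢ u-v) (colour-within≢across (sym a-side) a-v)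
    where
    a-v : side a ≢ side v
    a-v eq = u-v (trans (sym a-side) eq)
    ua : Adj Ḡ u a
    ua = complement-adj (≢-sym a≢u) (sameSide⇒¬adj (sym a-side))
    av : Adj Ḡ a v
    av = complement-adj (side-≢⇒≢ a-v) a≁v

  rainbowViaMateOfTarget : Mate v b → adj G b u ≡ false → side u ≢ side v →
    Σ (Walk Ḡ u v) (RainbowPath colouring)
  rainbowViaMateOfTarget {v} {b} {u} (b-side , b≢v) b≁u u-v =
    ub ∷ bv ∷ [] ,
    rainbow₂ colouring ub bv (side-≢⇒≢ u-v) (λ eq → colour-within≢across b-side u-b (sym eq))
    where
    u-b : side u ≢ side b
    u-b eq = u-v (trans eq b-side)
    ub : Adj Ḡ u b
    ub = complement-adj (side-≢⇒≢ u-b) (trans (adj-sym G u b) b≁u)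
    bv : Adj Ḡ b v
    bv = complement-adj b≢v (sameSide⇒¬adj b-side)

  rainbowViaBothMates : Mate u a → Mate v b → adj G a b ≡ false → side u ≢ side v →
    Σ (Walk Ḡ u v) (RainbowPath colouring)
  rainbowViaBothMates {u} {a} {v} {b} (a-side , a≢u) (b-side , b≢v) a≁b u-v =
    ua ∷ ab ∷ bv ∷ [] ,
    rainbow₃ colouring ua ab bv (side-≢⇒≢ u-b) (side-≢⇒≢ u-v) (side-≢⇒≢ a-v)
      (colour-within≢across (sym a-side) a-b)
      (λ eq → u-b (colour-within-injective (sym a-side) b-side eq))
      (λ eq → colour-within≢across b-side a-b (sym eq))
    where
    a-b : side a ≢ side b
    a-b eq = u-v (trans (sym a-side) (trans eq b-side))
    u-b : side u ≢ side b
    u-b eq = u-v (trans eq b-side)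
    a-v : side a ≢ side v
    a-v eq = u-v (trans (sym a-side) eq)
    ua : Adj Ḡ u a
    ua = complement-adj (≢-sym a≢u) (sameSide⇒¬adj (sym a-side))
    ab : Adj Ḡ a b
    ab = complement-adj (side-≢⇒≢ a-b) a≁b
    bv : Adj Ḡ b v
    bv = complement-adj b≢v (sameSide⇒¬adj b-side)

  rainbowAcrossEdge : ¬ IsStar G → Adj G u v → Σ (Walk Ḡ u v) (RainbowPath colouring)
  rainbowAcrossEdge {u} {v} notStar uv with any? (nonNeighbourMate? u v)
  ... | yes (_ , a-mate , a≁v) = rainbowViaMateOfSource a-mate a≁v (side-≢ uv)
  ... | no noMateU with any? (nonNeighbourMate? v u)
  ...   | yes (_ , b-mate , b≁u) = rainbowViaMateOfTarget b-mate b≁u (side-≢ uv)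
  ...   | no noMateV with any? (mate? u) | any? (mate? v)
  ...     | no lonelyU | _ = ⊥-elim (notStar
              (lonely⇒star (noMate⇒lonely lonelyU) (adjacentToOtherSide uv noMateV)))
  ...     | yes _ | no lonelyV = ⊥-elim (notStar
              (lonely⇒star (noMate⇒lonely lonelyV) (adjacentToOtherSide (Adj-sym uv) noMateU)))
  ...     | yes (a , a-mate) | yes (b , b-mate) with adj G a b in ab
  ...       | false = rainbowViaBothMates a-mate b-mate ab (side-≢ uv)
  ...       | true  = ⊥-elim (acyclic (square⇒cycle uv va ab bu
                        (≢-sym (proj₂ a-mate)) (≢-sym (proj₂ b-mate))))
    where
    va : Adj G v a
    va = adjacentToOtherSide (Adj-sym uv) noMateU a
           λ eq → side-≢ uv (trans (sym (proj₁ a-mate)) eq)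
    bu : Adj G b u
    bu = Adj-sym (adjacentToOtherSide uv noMateV b
           λ eq → side-≢ uv (trans (sym eq) (proj₁ b-mate)))

  rainbowConnected : ¬ IsStar G → RainbowConnected colouring
  rainbowConnected notStar u v with u ≟ v
  ... | yes refl = [] , ([] ∷ []) , []
  ... | no u≢v with adj G u v in uv
  ...   | false = edge ∷ [] , rainbow₁ colouring edge
    where
    edge : Adj Ḡ u v
    edge = complement-adj u≢v uv
  ...   | true  = rainbowAcrossEdge notStar uv

proposition3p2 : ∀ {n : ℕ} (G : Graph n) → IsTree G → ¬ IsStar G →
    Connected (complement G) × rc≤ (complement G) 3
proposition3p2 {zero}  G _ _ = (λ ()) , record { col = λ () ; col-sym = λ () } , λ ()
proposition3p2 {suc _} G (connected , acyclic) notStar =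
  rainbowConnected⇒connected colouring rainbow , colouring , rainbow
  where
  open TreeComplement G connected acyclic fzero
  rainbow : RainbowConnected colouring
  rainbow = rainbowConnected notStar
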